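{- Let $T^*$ be an optimal solution of a UFP instance satisfying the standing assumptions below, let $k\ge2$ be an even integer, and let $\mathcal{D}$ be the tree constructed below from $\tilde L_R$ and $k$. Then there exists a segment cover $S'\subseteq\tilde L_R$ with $w(S')\le\frac{2}{k}\,w(\tilde L_R)$.
   Context: A UFP instance: a path with vertices $1,\dots,n$ from left to right, edges $e=(v,v+1)$ with capacities $u_e\in\mathbb{Z}_{>0}$, and a finite set $T$ of tasks labelled by distinct integers $1,\dots,|T|$; each task $i$ has a subpath $P(i)$ from $s(i)$ to $t(i)$, demand $d(i)>0$, profit $w(i)\ge0$. Feasible sets respect all capacities; $T^*$ is a feasible set of maximum profit. $b(i)=\min_{e\in P(i)}u_e$, $e(i)$ the edge of $P(i)$ with capacity $b(i)$. Standing assumptions: edge capacities pairwise distinct, $d(i)\le b(i)$, every vertex is start or end vertex of exactly one task. Segments: if $e(i)=(v,v+1)$, $\tilde\ell_R(i)=(1,t(i))\times\{b(i)+Mv+\frac{i}{|T|+1}\}$ with $M=1+\max_e u_e$, weight $w(i)$; $\tilde L_R=\{\tilde\ell_R(i): i\in T^*\}$; the weight of a set of segments is the sum of weights. A segment $(a,b)\times\{y\}$ contains edge $(v,v+1)$ if $a\le v$ and $v+1\le b$. Tree $\mathcal{D}$: a rooted directed out-tree whose nodes $w$ carry labels $(e_w,I_w,R_w)$, $e_w$ an edge, $I_w\subseteq[0,\infty)$ an interval, $R_w$ the set of segments of $\tilde L_R$ containing $e_w$ with $y$-coordinate in $I_w$. If no edge is contained in at least $k-1$ segments, $\mathcal D$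 has no nodes. Otherwise let $e_r$ be the rightmost edge contained in at least $k-1$ segments; the root has label $(e_r,[0,\infty),R_r)$. For a node $w$: if $e_w=(1,2)$, $w$ is a leaf. Otherwise let $e'$ be the edge immediately left of $e_w$ and $R'$ the segments containing $e'$ with $y$-coordinate in $I_w$. If $|R'|<k$, $w$ gets one child labelled $(e',I_w,R')$. Otherwise, sort $R'$ by increasing $y$-coordinate $y_1<y_2<\dots$, let $R_b$ be the first $k/2$ and $R_t$ the remaining ones, choose $y_0$ with $y_{k/2}<y_0\le y_{k/2+1}$, and give $w$ two children labelled $(e',I_w\cap[0,y_0),R_b)$ and $(e',I_w\cap[y_0,\infty),R_t)$. A segment cover is a set $S'\subseteq\tilde L_R$ with $S'\cap R_w\ne\emptyset$ for every node $w$ of $\mathcal D$. -}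

module Defs where

open import Data.Nat as ℕ using (ℕ; zero; suc; _∸_; _<ᵇ_)
open import Data.Rational as ℚ using (ℚ; 0ℚ; _≤ᵇ_)
open import Data.Integer using (+_)
open import Data.Bool using (Bool; true; false; if_then_else_; _∧_; not)
open import Data.Maybe using (Maybe; just; nothing; maybe)
open import Data.List using (List; []; _∷_; filter; length; upTo; map)
open import Data.Product using (Σ; _×_; _,_; ∃)
open import Data.Sum using (_⊎_)
open import Relation.Binary.PropositionalEquality using (_≡_; _≢_)
open import Relation.Nullary using (¬_)
open import Relation.Nullary.Decidable using (does)
open import Data.Bool.Properties using (T?)
open import Data.Unit using (⊤)

-- A UFP instance on a path with vertices 1..n.
-- Edge (v,v+1) is indexed by its left vertex v (1 ≤ v < n), capacity u v.
-- Tasks are labelled 1..m; task i has subpath from s i to t i,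
-- demand d i and profit w i.  Values of the functions outside the
-- relevant ranges are irrelevant.

record UFP : Set where
  field
    n : ℕ
    u : ℕ → ℕ
    m : ℕ
    s : ℕ → ℕ
    t : ℕ → ℕ
    d : ℕ → ℚ
    w : ℕ → ℚ

record WellFormed (I : UFP) : Set where
  open UFP I
  field
    u-pos : ∀ v → 1 ℕ.≤ v → v ℕ.< n → 1 ℕ.≤ u v
    s-range : ∀ i → 1 ℕ.≤ i → i ℕ.≤ m → 1 ℕ.≤ s i
    s<t : ∀ i → 1 ℕ.≤ i → i ℕ.≤ m → s i ℕ.< t i
    t-range : ∀ i → 1 ℕ.≤ i → i ℕ.≤ m → t i ℕ.≤ n
    d-pos : ∀ i → 1 ℕ.≤ i → i ℕ.≤ m → 0ℚ ℚ.< d i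
    w-nonneg : ∀ i → 1 ℕ.≤ i → i ℕ.≤ m → 0ℚ ℚ.≤ w i

ι : ℕ → ℚ
ι k = (+ k) ℚ./ 1

sumTo : ℕ → (ℕ → ℚ) → ℚ
sumTo zero f = 0ℚ
sumTo (suc k) f = sumTo k f ℚ.+ f (suc k)

TaskSet : Set
TaskSet = ℕ → Bool

_⊆ₜ_ : TaskSet → TaskSet → Set
A ⊆ₜ B = ∀ i → A i ≡ true → B i ≡ true

labels : ℕ → List ℕ
labels m = map suc (upTo m)

minU : (ℕ → ℕ) → ℕ → ℕ → ℕ
minU u a zero = u a
minU u a (suc l) = u (a ℕ.+ suc l) ℕ.⊓ minU u a l

argminU : (ℕ → ℕ) → ℕ → ℕ → ℕ
argminU u a zero = a
argminU u a (suc l) =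
  if u (a ℕ.+ suc l) <ᵇ minU u a l then a ℕ.+ suc l else argminU u a l

maxU : (ℕ → ℕ) → ℕ → ℕ
maxU u zero = 0
maxU u (suc k) = u (suc k) ℕ.⊔ maxU u k

-- Shapes of (sub)trees of 𝒟: a node has no child (leaf), one child, or
-- two children (with the chosen threshold y0).  The labels
-- (e_w, I_w, R_w) of the nodes are determined from the root label.
data DTree : Set where
  leaf : DTree
  one  : DTree → DTree
  two  : ℚ → DTree → DTree → DTree

module _ (I : UFP) where
  open UFP I

  uses : ℕ → ℕ → Set
  uses i v = (s i ℕ.≤ v) × (suc v ℕ.≤ t i)

  usesᵇ : ℕ → ℕ → Bool
  usesᵇ i v = (s i ℕ.≤ᵇ v) ∧ (suc v ℕ.≤ᵇ t i)

  b : ℕ → ℕ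
  b i = minU u (s i) (t i ∸ s i ∸ 1)

  eL : ℕ → ℕ
  eL i = argminU u (s i) (t i ∸ s i ∸ 1)

  weight : TaskSet → ℚ
  weight S = sumTo m (λ i → if S i then w i else 0ℚ)

  load : TaskSet → ℕ → ℚ
  load S v = sumTo m (λ i → if S i ∧ usesᵇ i v then d i else 0ℚ)

  Feasible : TaskSet → Set
  Feasible S = ∀ v → 1 ℕ.≤ v → v ℕ.< n → load S v ℚ.≤ ι (u v)

  Optimal : TaskSet → Set
  Optimal S = Feasible S × (∀ S' → Feasible S' → weight S' ℚ.≤ weight S)

  record Standing : Set where
    field
      wf : WellFormed I
      cap-distinct : ∀ v v' → 1 ℕ.≤ v → v ℕ.< n → 1 ℕ.≤ v' → v' ℕ.< n →
                     v ≢ v' → u v ≢ u v'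
      d≤b : ∀ i → 1 ℕ.≤ i → i ℕ.≤ m → d i ℚ.≤ ι (b i)
      endpoint-unique : ∀ v → 1 ℕ.≤ v → v ℕ.≤ n →
        Σ ℕ λ i → (1 ℕ.≤ i) × (i ℕ.≤ m) × ((s i ≡ v) ⊎ (t i ≡ v)) ×
          (∀ j → 1 ℕ.≤ j → j ℕ.≤ m → (s j ≡ v) ⊎ (t j ≡ v) → j ≡ i)

  M : ℕ
  M = suc (maxU u (n ∸ 1))

  -- y-coordinate of the segment ℓ̃_R(i) = (1, t(i)) × {y i}
  y : ℕ → ℚ
  y i = ι (b i ℕ.+ M ℕ.* eL i) ℚ.+ ((+ i) ℚ./ suc m)

  segContainsᵇ : ℕ → ℕ → Bool
  segContainsᵇ i v = (1 ℕ.≤ᵇ v) ∧ (suc v ℕ.≤ᵇ t i)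

  -- intervals [lo, hi) ⊆ [0,∞);  hi = nothing means hi = ∞
  record Interval : Set where
    constructor [_,_⟩
    field
      lo : ℚ
      hi : Maybe ℚ

  inIntᵇ : Interval → ℚ → Bool
  inIntᵇ [ lo , hi ⟩ z = (lo ≤ᵇ z) ∧ maybe (λ h → not (h ≤ᵇ z)) true hi

  whole : Interval
  whole = [ 0ℚ , nothing ⟩

  below : Interval → ℚ → Interval
  below [ lo , hi ⟩ y0 = [ lo , just (maybe (λ h → h ℚ.⊓ y0) y0 hi) ⟩

  above : Interval → ℚ → Interval
  above [ lo , hi ⟩ y0 = [ lo ℚ.⊔ y0 , hi ⟩

  module _ (Tstar : TaskSet) where
    -- segments of L̃_R are ℓ̃_R(i), i ∈ T*; they are pairwise distinct
    -- (distinct y-coordinates), so we identify ℓ̃_R(i) with its task i.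
    -- i ∈ R(v, J): ℓ̃_R(i) ∈ L̃_R contains edge (v,v+1) and y i ∈ J
    inRᵇ : ℕ → Interval → ℕ → Bool
    inRᵇ v J i = Tstar i ∧ segContainsᵇ i v ∧ inIntᵇ J (y i)

    R : ℕ → Interval → List ℕ
    R v J = filter (λ i → T? (inRᵇ v J i)) (labels m)

    cnt : ℕ → Interval → ℕ
    cnt v J = length (R v J)

    -- ValidNode k v J D : D is the subtree built by the construction
    -- below a node labelled (edge (v,v+1), J, R v J).
    data ValidNode (k : ℕ) : ℕ → Interval → DTree → Set where
      v-leaf : ∀ {J} → ValidNode k 1 J leaf
      v-one  : ∀ {v J D} → 1 ℕ.≤ v → cnt v J ℕ.< k →
               ValidNode k v J D → ValidNode k (suc v) J (one D)
      v-two  : ∀ {v J y0 Db Dt} → 1 ℕ.≤ v → k ℕ.≤ cnt v J →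
               -- y_{k/2} < y0 ≤ y_{k/2+1}: exactly k/2 segments of R'
               -- have y-coordinate below y0
               cnt v (below J y0) ≡ k ℕ./ 2 →
               ValidNode k v (below J y0) Db →
               ValidNode k v (above J y0) Dt →
               ValidNode k (suc v) J (two y0 Db Dt)

    -- the tree 𝒟: nothing = no nodes; just (v , D) = root labelled
    -- (edge (v,v+1), [0,∞), R v [0,∞)) with subtree shape D
    IsTreeD : ℕ → Maybe (ℕ × DTree) → Set
    IsTreeD k nothing =
      ∀ v → 1 ℕ.≤ v → v ℕ.< n → cnt v whole ℕ.< k ∸ 1
    IsTreeD k (just (r , D)) =
      (1 ℕ.≤ r) × (r ℕ.< n) × (k ∸ 1 ℕ.≤ cnt r whole) ×
      (∀ v → r ℕ.< v → v ℕ.< n → cnt v whole ℕ.< k ∸ 1) ×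
      ValidNode k r whole D

    HitsAll : TaskSet → ℕ → Interval → DTree → Set
    HitsAll S v J D = (∃ λ i → (S i ≡ true) × (inRᵇ v J i ≡ true)) × rest D
      where
      rest : DTree → Set
      rest leaf = ⊤
      rest (one D') = HitsAll S (v ∸ 1) J D'
      rest (two y0 Db Dt) =
        HitsAll S (v ∸ 1) (below J y0) Db × HitsAll S (v ∸ 1) (above J y0) Dt

    SegmentCover : Maybe (ℕ × DTree) → TaskSet → Set
    SegmentCover nothing S = S ⊆ₜ Tstar
    SegmentCover (just (r , D)) S = (S ⊆ₜ Tstar) × HitsAll S r whole D

module Submission where

-- With q = k/2 colours, colour the segments of L̃_R greedily from the root of 𝒟
-- downwards so that every R_w receives a segment of every colour.  At a node w
-- the segments coloured so far were coloured at ancestors of w, so they lie in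
-- R_w and carry pairwise distinct colours; since |R_w| ≥ q, the missing colours
-- can be given to uncoloured members of R_w (pigeonhole).  The bound |R_w| ≥ q
-- holds everywhere: all segments start at vertex 1, so R only grows when one
-- moves left within the same interval, a bottom child has exactly k/2 segments,
-- and a top child has |R'| − k/2 ≥ k/2 of them.  Every colour class is then a
-- segment cover, the classes are disjoint subsets of L̃_R, and the cheapest
-- one weighs at most w(L̃_R)/q = (2/k)·w(L̃_R).

open import Defs
open import Data.Nat using (ℕ; _≤_)
open import Data.Nat.Divisibility using (_∣_)
open import Data.Rational as ℚ using (ℚ)
open import Data.Maybe using (Maybe)
open import Data.Product using (_×_; ∃)

open import Algebra.Bundles using (CommutativeMonoid)
open import Data.Bool using (Bool; true; false; T; _∧_; not; if_then_else_)
open import Data.Bool.Properties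
  using (T?; T-≡; ∧-assoc; ∧-conicalˡ; ∧-conicalʳ; ∧-identityʳ; ∧-zeroʳ)
open import Data.Empty using (⊥; ⊥-elim)
open import Data.Integer as ℤ using (+_)
import Data.Integer.Properties as ℤP
open import Data.List using ([]; _∷_; _++_; _∷ʳ_; filter; length; map; upTo)
open import Data.List.Properties using (upTo-∷ʳ; map-++; filter-++; length-++)
open import Data.Maybe using (just; nothing; maybe)
import Data.Nat as ℕ
open import Data.Nat using (zero; suc; _+_; _*_; _∸_; _≟_; z≤n; s≤s)
open import Data.Nat.Divisibility using (divides)
open import Data.Nat.DivMod using (m*n/n≡m)
import Data.Nat.Properties as ℕP
open import Data.Nat.Tactic.RingSolver using (solve)
open import Data.Product using (_,_; proj₁; proj₂; map₂)
open import Data.Rational using (0ℚ; _≤ᵇ_; _⊓_; _⊔_)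
import Data.Rational.Properties as ℚP
open import Data.Rational.Unnormalised as ℚᵘ using (mkℚᵘ; *≡*)
import Data.Rational.Unnormalised.Properties as ℚᵘP
open import Data.Sum using (_⊎_; inj₁; inj₂; [_,_])
open import Data.Unit using (tt)
open import Function using (case_of_; _∘_; Equivalence)
open import Relation.Binary.PropositionalEquality
  using (_≡_; _≢_; refl; sym; trans; cong; cong₂; subst; subst₂; module ≡-Reasoning)
open import Relation.Nullary using (¬_)
open import Relation.Nullary.Decidable using (Dec; yes; no; does; dec-true; dec-false)
open import Algebra.Properties.CommutativeSemigroup
  (CommutativeMonoid.commutativeSemigroup ℚP.+-0-commutativeMonoid)
  using () renaming (interchange to +-interchange)

T⇒≡true : ∀ {b} → T b → b ≡ true
T⇒≡true = Equivalence.to T-≡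

≡true⇒T : ∀ {b} → b ≡ true → T b
≡true⇒T = Equivalence.from T-≡

true≢false : ∀ {b} → b ≡ true → b ≡ false → ⊥
true≢false refl ()

∧-intro : ∀ {a b} → a ≡ true → b ≡ true → a ∧ b ≡ true
∧-intro refl refl = refl

∧-falseʳ : ∀ {a b} → a ≡ true → a ∧ b ≡ false → b ≡ false
∧-falseʳ refl f = f

not≡true : ∀ {b} → not b ≡ true → b ≡ false
not≡true {false} _ = refl

not≡false : ∀ {b} → not b ≡ false → b ≡ true
not≡false {true} _ = refl

contraposeᵇ : ∀ {a b} → (a ≡ true → b ≡ true) → b ≡ false → a ≡ false
contraposeᵇ {false} _   _  = refl
contraposeᵇ {true}  a⇒b bf = ⊥-elim (true≢false (a⇒b refl) bf)

excludes-sym : ∀ {a b} → (a ≡ true → b ≡ false) → b ≡ true → a ≡ false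
excludes-sym {false} _    _  = refl
excludes-sym {true}  a⇒¬b bt = ⊥-elim (true≢false bt (a⇒¬b refl))

witness : ∀ {A : Set} (a? : Dec A) → does a? ≡ true → A
witness (yes a) _ = a

-- Counting over the labels 1, …, m

Label : ℕ → ℕ → Set
Label m i = 1 ≤ i × i ≤ m

Label-zero : ∀ {i} → ¬ Label 0 i
Label-zero (() , z≤n)

Label-weaken : ∀ {m i} → Label m i → Label (suc m) i
Label-weaken (1≤i , i≤m) = 1≤i , ℕP.m≤n⇒m≤1+n i≤m

Label-last : ∀ m → Label (suc m) (suc m)
Label-last m = s≤s z≤n , ℕP.≤-refl

Label-split : ∀ {m i} → Label (suc m) i → Label m i ⊎ i ≡ suc m
Label-split (1≤i , i≤1+m) with ℕP.m≤n⇒m<n∨m≡n i≤1+m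
... | inj₁ (s≤s i≤m) = inj₁ (1≤i , i≤m)
... | inj₂ i≡1+m     = inj₂ i≡1+m

search : ∀ m (p : ℕ → Bool) →
         (∃ λ i → Label m i × p i ≡ true) ⊎ (∀ i → Label m i → p i ≡ false)
search zero    p = inj₂ λ i li → ⊥-elim (Label-zero li)
search (suc m) p with p (suc m) in pm | search m p
... | true  | _                  = inj₁ (suc m , Label-last m , pm)
... | false | inj₁ (i , li , pi) = inj₁ (i , Label-weaken li , pi)
... | false | inj₂ none          = inj₂ λ i li → [ none i , (λ { refl → pm }) ] (Label-split li)

count : ℕ → (ℕ → Bool) → ℕ
count zero    p = 0
count (suc m) p = count m p + (if p (suc m) then 1 else 0)

indicator≤1 : ∀ b → (if b then 1 else 0) ≤ 1
indicator≤1 true  = ℕP.≤-refl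
indicator≤1 false = z≤n

count-cong : ∀ m {p p′ : ℕ → Bool} → (∀ i → Label m i → p i ≡ p′ i) → count m p ≡ count m p′
count-cong zero    eq = refl
count-cong (suc m) eq =
  cong₂ _+_ (count-cong m (λ i li → eq i (Label-weaken li)))
            (cong (λ b → if b then 1 else 0) (eq (suc m) (Label-last m)))

count-mono : ∀ m {p p′ : ℕ → Bool} →
             (∀ i → Label m i → p i ≡ true → p′ i ≡ true) → count m p ≤ count m p′
count-mono zero    _ = z≤n
count-mono (suc m) {p} {p′} p⇒p′ =
  ℕP.+-mono-≤ (count-mono m (λ i li → p⇒p′ i (Label-weaken li))) last
  where
  last : (if p (suc m) then 1 else 0) ≤ (if p′ (suc m) then 1 else 0)
  last with p (suc m) in pm
  ... | false = z≤n
  ... | true rewrite p⇒p′ (suc m) (Label-last m) pm = ℕP.≤-refl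

count-≤ : ∀ m p → count m p ≤ m
count-≤ zero    p = z≤n
count-≤ (suc m) p = begin
  count m p + (if p (suc m) then 1 else 0) ≤⟨ ℕP.+-mono-≤ (count-≤ m p) (indicator≤1 (p (suc m))) ⟩
  m + 1                                    ≡⟨ ℕP.+-comm m 1 ⟩
  suc m                                    ∎
  where open ℕP.≤-Reasoning

count-none : ∀ m {p} → (∀ i → Label m i → p i ≡ false) → count m p ≡ 0
count-none zero    _    = refl
count-none (suc m) none
  rewrite count-none m (λ i li → none i (Label-weaken li)) | none (suc m) (Label-last m) = refl

count-pos : ∀ m p → 1 ≤ count m p → ∃ λ i → Label m i × p i ≡ true
count-pos m p 1≤count with search m p
... | inj₁ found = found
... | inj₂ none  = ⊥-elim (ℕP.<⇒≢ 1≤count (sym (count-none m none)))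

count-≤1 : ∀ m {p} → (∀ i j → Label m i → Label m j → p i ≡ true → p j ≡ true → i ≡ j) →
           count m p ≤ 1
count-≤1 zero    _ = z≤n
count-≤1 (suc m) {p} unique with p (suc m) in pm
... | false = ℕP.≤-trans (ℕP.≤-reflexive (ℕP.+-identityʳ _))
                         (count-≤1 m λ i j li lj → unique i j (Label-weaken li) (Label-weaken lj))
... | true  = ℕP.≤-reflexive (cong (_+ 1) (count-none m others))
  where
  others : ∀ i → Label m i → p i ≡ false
  others i li@(_ , i≤m) with p i in pi
  ... | false = refl
  ... | true  = ⊥-elim (ℕP.<⇒≢ (s≤s i≤m) (sym (unique (suc m) i (Label-last m) (Label-weaken li) pm pi)))

count-split : ∀ m (p a : ℕ → Bool) →
              count m p ≡ count m (λ i → p i ∧ a i) + count m (λ i → p i ∧ not (a i))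
count-split zero    p a = refl
count-split (suc m) p a rewrite count-split m p a =
  last-summand (count m (λ i → p i ∧ a i)) (count m (λ i → p i ∧ not (a i))) (p (suc m)) (a (suc m))
  where
  last-summand : ∀ x y b c → x + y + (if b then 1 else 0) ≡
                             x + (if b ∧ c then 1 else 0) + (y + (if b ∧ not c then 1 else 0))
  last-summand x y false c     = solve (x ∷ y ∷ [])
  last-summand x y true  true  = solve (x ∷ y ∷ [])
  last-summand x y true  false = solve (x ∷ y ∷ [])

length-filter-labels : ∀ m p → length (filter (λ i → T? (p i)) (labels m)) ≡ count m p
length-filter-labels zero    p = refl
length-filter-labels (suc m) p = begin
  length (filter P (map suc (upTo (suc m))))
    ≡⟨ cong (λ l → length (filter P (map suc l))) (sym (upTo-∷ʳ m)) ⟩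
  length (filter P (map suc (upTo m ∷ʳ m)))
    ≡⟨ cong (λ l → length (filter P l)) (map-++ suc (upTo m) (m ∷ [])) ⟩
  length (filter P (labels m ++ suc m ∷ []))
    ≡⟨ cong length (filter-++ P (labels m) (suc m ∷ [])) ⟩
  length (filter P (labels m) ++ filter P (suc m ∷ []))
    ≡⟨ length-++ (filter P (labels m)) ⟩
  length (filter P (labels m)) + length (filter P (suc m ∷ []))
    ≡⟨ cong₂ _+_ (length-filter-labels m p) singleton ⟩
  count m p + (if p (suc m) then 1 else 0) ∎
  where
  open ≡-Reasoning
  P = λ i → T? (p i)
  singleton : length (filter P (suc m ∷ [])) ≡ (if p (suc m) then 1 else 0)
  singleton with p (suc m)
  ... | true  = refl
  ... | false = refl

count-injective : ∀ q m {p C : ℕ → Bool} (f : ℕ → ℕ) →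
  (∀ i → Label m i → p i ≡ true → Label q (f i) × C (f i) ≡ true) →
  (∀ i j → Label m i → Label m j → p i ≡ true → p j ≡ true → f i ≡ f j → i ≡ j) →
  count m p ≤ count q C
count-injective zero m {p} f into _ = ℕP.≤-reflexive (count-none m none)
  where
  none : ∀ i → Label m i → p i ≡ false
  none i li with p i in pi
  ... | false = refl
  ... | true  = ⊥-elim (Label-zero (proj₁ (into i li pi)))
count-injective (suc q) m {p} {C} f into inj = begin
  count m p                                                        ≡⟨ count-split m p top ⟩
  count m (λ i → p i ∧ top i) + count m (λ i → p i ∧ not (top i)) ≤⟨ ℕP.+-mono-≤ top-count rest-count ⟩
  (if C (suc q) then 1 else 0) + count q C                         ≡⟨ ℕP.+-comm _ (count q C) ⟩
  count (suc q) C                                                  ∎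
  where
  open ℕP.≤-Reasoning
  top : ℕ → Bool
  top i = does (f i ≟ suc q)
  avoids-top : ∀ i → Label m i → p i ∧ not (top i) ≡ true → Label q (f i) × C (f i) ≡ true
  avoids-top i li e with lfi , cfi ← into i li (∧-conicalˡ (p i) _ e) | Label-split lfi
  ... | inj₁ lfi′   = lfi′ , cfi
  ... | inj₂ fi≡top =
    ⊥-elim (true≢false (∧-conicalʳ (p i) _ e) (cong not (dec-true (f i ≟ suc q) fi≡top)))
  rest-count : count m (λ i → p i ∧ not (top i)) ≤ count q C
  rest-count = count-injective q m f avoids-top λ i j li lj ei ej →
    inj i j li lj (∧-conicalˡ (p i) _ ei) (∧-conicalˡ (p j) _ ej)
  top-count : count m (λ i → p i ∧ top i) ≤ (if C (suc q) then 1 else 0)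
  top-count with C (suc q) in cq
  ... | true  = count-≤1 m λ i j li lj ei ej →
    inj i j li lj (∧-conicalˡ (p i) _ ei) (∧-conicalˡ (p j) _ ej)
        (trans (witness (f i ≟ suc q) (∧-conicalʳ (p i) _ ei))
               (sym (witness (f j ≟ suc q) (∧-conicalʳ (p j) _ ej))))
  ... | false = ℕP.≤-reflexive (count-none m none)
    where
    none : ∀ i → Label m i → p i ∧ top i ≡ false
    none i li with p i ∧ top i in e
    ... | false = refl
    ... | true  = ⊥-elim (true≢false C-top cq)
      where
      C-top : C (suc q) ≡ true
      C-top = subst (λ c → C c ≡ true) (witness (f i ≟ suc q) (∧-conicalʳ (p i) _ e))
                    (proj₂ (into i li (∧-conicalˡ (p i) _ e)))

count-missing : ∀ q {s} → Label q s → suc (count q (λ c → not (does (c ≟ s)))) ≤ q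
count-missing zero    ls = ⊥-elim (Label-zero ls)
count-missing (suc q) {s} ls with Label-split ls
... | inj₂ refl rewrite dec-true (suc q ≟ suc q) refl =
  s≤s (ℕP.≤-trans (ℕP.≤-reflexive (ℕP.+-identityʳ _)) (count-≤ q _))
... | inj₁ ls′ = s≤s (begin
  count q others + (if others (suc q) then 1 else 0) ≤⟨ ℕP.+-monoʳ-≤ (count q others) (indicator≤1 _) ⟩
  count q others + 1                                  ≡⟨ ℕP.+-comm _ 1 ⟩
  suc (count q others)                                ≤⟨ count-missing q ls′ ⟩
  q                                                   ∎)
  where
  open ℕP.≤-Reasoning
  others : ℕ → Bool
  others c = not (does (c ≟ s))

q*2≡q+q : ∀ q → q * 2 ≡ q + q
q*2≡q+q q = solve (q ∷ [])

1≤half : ∀ {k q} → 2 ≤ k → k ≡ q * 2 → 1 ≤ q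
1≤half {q = zero}  () refl
1≤half {q = suc q} _   _    = s≤s z≤n

half≤pred : ∀ {k q} → 2 ≤ k → k ≡ q * 2 → q ≤ k ∸ 1
half≤pred {q = q} 2≤k refl = begin
  q           ≤⟨ ℕP.m≤m+n q (q ∸ 1) ⟩
  q + (q ∸ 1) ≡⟨ ℕP.+-∸-assoc q (1≤half 2≤k refl) ⟨
  q + q ∸ 1   ≡⟨ cong (_∸ 1) (q*2≡q+q q) ⟨
  q * 2 ∸ 1   ∎
  where open ℕP.≤-Reasoning

-- Finite sums of rationals

toℚᵘ-ι : ∀ n → ℚ.toℚᵘ (ι n) ℚᵘ.≃ mkℚᵘ (+ n) 0
toℚᵘ-ι n = ℚP.toℚᵘ-fromℚᵘ (mkℚᵘ (+ n) 0)

ι-+ : ∀ a b → ι (a + b) ≡ ι a ℚ.+ ι b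
ι-+ a b = ℚP.toℚᵘ-injective (begin
  ℚ.toℚᵘ (ι (a + b))             ≈⟨ toℚᵘ-ι (a + b) ⟩
  mkℚᵘ (+ (a + b)) 0             ≈⟨ *≡* (cong (ℤ._* + 1) numerators) ⟩
  mkℚᵘ (+ a) 0 ℚᵘ.+ mkℚᵘ (+ b) 0 ≈⟨ ℚᵘP.≃-sym (ℚᵘP.+-cong (toℚᵘ-ι a) (toℚᵘ-ι b)) ⟩
  ℚ.toℚᵘ (ι a) ℚᵘ.+ ℚ.toℚᵘ (ι b) ≈⟨ ℚᵘP.≃-sym (ℚP.toℚᵘ-homo-+ (ι a) (ι b)) ⟩
  ℚ.toℚᵘ (ι a ℚ.+ ι b)           ∎)
  where
  open ℚᵘP.≃-Reasoning
  numerators : + (a + b) ≡ + a ℤ.* + 1 ℤ.+ + b ℤ.* + 1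
  numerators = trans (ℤP.pos-+ a b) (sym (cong₂ ℤ._+_ (ℤP.*-identityʳ (+ a)) (ℤP.*-identityʳ (+ b))))

ι-* : ∀ a b → ι (a * b) ≡ ι a ℚ.* ι b
ι-* a b = ℚP.toℚᵘ-injective (begin
  ℚ.toℚᵘ (ι (a * b))             ≈⟨ toℚᵘ-ι (a * b) ⟩
  mkℚᵘ (+ (a * b)) 0             ≈⟨ *≡* (cong (ℤ._* + 1) (ℤP.pos-* a b)) ⟩
  mkℚᵘ (+ a) 0 ℚᵘ.* mkℚᵘ (+ b) 0 ≈⟨ ℚᵘP.≃-sym (ℚᵘP.*-cong (toℚᵘ-ι a) (toℚᵘ-ι b)) ⟩
  ℚ.toℚᵘ (ι a) ℚᵘ.* ℚ.toℚᵘ (ι b) ≈⟨ ℚᵘP.≃-sym (ℚP.toℚᵘ-homo-* (ι a) (ι b)) ⟩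
  ℚ.toℚᵘ (ι a ℚ.* ι b)           ∎)
  where open ℚᵘP.≃-Reasoning

double-scaling : ∀ {k} q {x y} → k ≡ q * 2 → ι q ℚ.* x ℚ.≤ y → ι k ℚ.* x ℚ.≤ ι 2 ℚ.* y
double-scaling {k} q {x} {y} k≡q*2 qx≤y = begin
  ι k ℚ.* x           ≡⟨ cong (λ n → ι n ℚ.* x) (trans k≡q*2 (ℕP.*-comm q 2)) ⟩
  ι (2 * q) ℚ.* x     ≡⟨ cong (ℚ._* x) (ι-* 2 q) ⟩
  ι 2 ℚ.* ι q ℚ.* x   ≡⟨ ℚP.*-assoc (ι 2) (ι q) x ⟩
  ι 2 ℚ.* (ι q ℚ.* x) ≤⟨ ℚP.*-monoˡ-≤-nonNeg (ι 2) qx≤y ⟩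
  ι 2 ℚ.* y           ∎
  where open ℚP.≤-Reasoning

sumTo-cong : ∀ m {f g : ℕ → ℚ} → (∀ i → Label m i → f i ≡ g i) → sumTo m f ≡ sumTo m g
sumTo-cong zero    _  = refl
sumTo-cong (suc m) eq =
  cong₂ ℚ._+_ (sumTo-cong m (λ i li → eq i (Label-weaken li))) (eq (suc m) (Label-last m))

sumTo-mono : ∀ m {f g : ℕ → ℚ} → (∀ i → Label m i → f i ℚ.≤ g i) → sumTo m f ℚ.≤ sumTo m g
sumTo-mono zero    _  = ℚP.≤-refl
sumTo-mono (suc m) le =
  ℚP.+-mono-≤ (sumTo-mono m (λ i li → le i (Label-weaken li))) (le (suc m) (Label-last m))

sumTo-zero : ∀ m {f : ℕ → ℚ} → (∀ i → Label m i → f i ≡ 0ℚ) → sumTo m f ≡ 0ℚ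
sumTo-zero m eq = trans (sumTo-cong m eq) (sum-of-zeros m)
  where
  sum-of-zeros : ∀ m → sumTo m (λ _ → 0ℚ) ≡ 0ℚ
  sum-of-zeros zero    = refl
  sum-of-zeros (suc m) rewrite sum-of-zeros m = refl

sumTo-+ : ∀ m (f g : ℕ → ℚ) → sumTo m (λ i → f i ℚ.+ g i) ≡ sumTo m f ℚ.+ sumTo m g
sumTo-+ zero    f g = refl
sumTo-+ (suc m) f g rewrite sumTo-+ m f g =
  +-interchange (sumTo m f) (sumTo m g) (f (suc m)) (g (suc m))

sumTo-swap : ∀ q m (F : ℕ → ℕ → ℚ) →
             sumTo q (λ c → sumTo m (F c)) ≡ sumTo m (λ i → sumTo q (λ c → F c i))
sumTo-swap zero    m F = sym (sumTo-zero m (λ _ _ → refl))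
sumTo-swap (suc q) m F rewrite sumTo-swap q m F =
  sym (sumTo-+ m (λ i → sumTo q (λ c → F c i)) (F (suc q)))

sumTo-const : ∀ m x → sumTo m (λ _ → x) ≡ ι m ℚ.* x
sumTo-const zero    x = sym (ℚP.*-zeroˡ x)
sumTo-const (suc m) x = begin
  sumTo m (λ _ → x) ℚ.+ x ≡⟨ cong₂ ℚ._+_ (sumTo-const m x) (sym (ℚP.*-identityˡ x)) ⟩
  ι m ℚ.* x ℚ.+ ι 1 ℚ.* x ≡⟨ ℚP.*-distribʳ-+ x (ι m) (ι 1) ⟨
  (ι m ℚ.+ ι 1) ℚ.* x     ≡⟨ cong (ℚ._* x) (ι-+ m 1) ⟨
  ι (m + 1) ℚ.* x         ≡⟨ cong (λ n → ι n ℚ.* x) (ℕP.+-comm m 1) ⟩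
  ι (suc m) ℚ.* x         ∎
  where open ≡-Reasoning

sumTo-single : ∀ q {x} (a : ℚ) → Label q x → sumTo q (λ c → if does (x ≟ c) then a else 0ℚ) ≡ a
sumTo-single zero    a lx = ⊥-elim (Label-zero lx)
sumTo-single (suc q) {x} a lx with Label-split lx
... | inj₁ lx′@(_ , x≤q)
  rewrite sumTo-single q a lx′ | dec-false (x ≟ suc q) (ℕP.<⇒≢ (s≤s x≤q)) = ℚP.+-identityʳ a
... | inj₂ refl
  rewrite sumTo-zero q (λ c (_ , c≤q) →
            cong (λ b → if b then a else 0ℚ) (dec-false (suc q ≟ c) (ℕP.>⇒≢ (s≤s c≤q))))
        | dec-true (suc q ≟ suc q) refl = ℚP.+-identityˡ a

minimiser : ∀ q (W : ℕ → ℚ) → 1 ≤ q →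
            ∃ λ c → Label q c × (∀ c′ → Label q c′ → W c ℚ.≤ W c′)
minimiser (suc zero) W _ = 1 , Label-last 0 ,
  λ c′ lc′ → [ ⊥-elim ∘ Label-zero , (λ { refl → ℚP.≤-refl }) ] (Label-split lc′)
minimiser (suc (suc q)) W _ with c , lc , min ← minimiser (suc q) W (s≤s z≤n)
                               with ℚP.≤-total (W c) (W (suc (suc q)))
... | inj₁ le = c , Label-weaken lc ,
  λ c′ lc′ → [ min c′ , (λ { refl → le }) ] (Label-split lc′)
... | inj₂ ge = suc (suc q) , Label-last (suc q) ,
  λ c′ lc′ → [ (λ l → ℚP.≤-trans ge (min c′ l)) , (λ { refl → ℚP.≤-refl }) ] (Label-split lc′)

cheapest : ∀ q (W : ℕ → ℚ) → 1 ≤ q → ∃ λ c → Label q c × ι q ℚ.* W c ℚ.≤ sumTo q W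
cheapest q W 1≤q with c , lc , min ← minimiser q W 1≤q = c , lc , (begin
  ι q ℚ.* W c         ≡⟨ sumTo-const q (W c) ⟨
  sumTo q (λ _ → W c) ≤⟨ sumTo-mono q min ⟩
  sumTo q W           ∎)
  where open ℚP.≤-Reasoning

-- Intervals

≤⇒≤ᵇ≡true : ∀ {p q} → p ℚ.≤ q → (p ≤ᵇ q) ≡ true
≤⇒≤ᵇ≡true p≤q = T⇒≡true (ℚP.≤⇒≤ᵇ p≤q)

≤ᵇ≡true⇒≤ : ∀ {p q} → (p ≤ᵇ q) ≡ true → p ℚ.≤ q
≤ᵇ≡true⇒≤ eq = ℚP.≤ᵇ⇒≤ (≡true⇒T eq)

>⇒≤ᵇ≡false : ∀ {p q} → q ℚ.< p → (p ≤ᵇ q) ≡ false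
>⇒≤ᵇ≡false {p} {q} q<p with p ≤ᵇ q in eq
... | false = refl
... | true  = ⊥-elim (ℚP.<-irrefl refl (ℚP.<-≤-trans q<p (≤ᵇ≡true⇒≤ eq)))

≤ᵇ≡false⇒> : ∀ {p q} → (p ≤ᵇ q) ≡ false → q ℚ.< p
≤ᵇ≡false⇒> eq = ℚP.≰⇒> λ p≤q → true≢false (≤⇒≤ᵇ≡true p≤q) eq

module _ (I : UFP) where

  private
    cap : Maybe ℚ → ℚ → ℚ
    cap hi y0 = maybe (λ h → h ⊓ y0) y0 hi

    upper : Maybe ℚ → ℚ → Bool
    upper hi z = maybe (λ h → not (h ≤ᵇ z)) true hi

    cap≤floor : ∀ lo hi y0 → cap hi y0 ℚ.≤ lo ⊔ y0
    cap≤floor lo nothing  y0 = ℚP.p≤q⊔p lo y0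
    cap≤floor lo (just h) y0 = ℚP.≤-trans (ℚP.p⊓q≤q h y0) (ℚP.p≤q⊔p lo y0)

    cap-reached : ∀ hi y0 z → upper hi z ≡ true → cap hi y0 ℚ.≤ z → y0 ℚ.≤ z
    cap-reached nothing  y0 z _ y0≤z = y0≤z
    cap-reached (just h) y0 z z<h cap≤z with ℚP.⊓-sel h y0
    ... | inj₁ h⊓y0≡h  =
      ⊥-elim (true≢false (≤⇒≤ᵇ≡true {h} {z} (subst (ℚ._≤ z) h⊓y0≡h cap≤z)) (not≡true z<h))
    ... | inj₂ h⊓y0≡y0 = subst (ℚ._≤ z) h⊓y0≡y0 cap≤z

  below-⊆ : ∀ J y0 z → inIntᵇ I (below I J y0) z ≡ true → inIntᵇ I J z ≡ true
  below-⊆ [ lo , nothing ⟩ y0 z e = ∧-intro (∧-conicalˡ (lo ≤ᵇ z) _ e) refl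
  below-⊆ [ lo , just h ⟩  y0 z e =
    ∧-intro (∧-conicalˡ (lo ≤ᵇ z) _ e) (cong not (>⇒≤ᵇ≡false {h} {z} z<h))
    where
    z<h : z ℚ.< h
    z<h = ℚP.<-≤-trans
      (≤ᵇ≡false⇒> {h ⊓ y0} (not≡true (∧-conicalʳ (lo ≤ᵇ z) (not (h ⊓ y0 ≤ᵇ z)) e)))
      (ℚP.p⊓q≤p h y0)

  above-⊆ : ∀ J y0 z → inIntᵇ I (above I J y0) z ≡ true → inIntᵇ I J z ≡ true
  above-⊆ [ lo , hi ⟩ y0 z e =
    ∧-intro (≤⇒≤ᵇ≡true {lo} {z} (ℚP.≤-trans (ℚP.p≤p⊔q lo y0) floor≤z)) z<hi
    where
    floor≤z : lo ⊔ y0 ℚ.≤ z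
    floor≤z = ≤ᵇ≡true⇒≤ {lo ⊔ y0} (∧-conicalˡ (lo ⊔ y0 ≤ᵇ z) (upper hi z) e)
    z<hi : upper hi z ≡ true
    z<hi = ∧-conicalʳ (lo ⊔ y0 ≤ᵇ z) (upper hi z) e

  below-above-disjoint : ∀ J y0 z → inIntᵇ I (below I J y0) z ≡ true → inIntᵇ I (above I J y0) z ≡ false
  below-above-disjoint [ lo , hi ⟩ y0 z e = cong (_∧ upper hi z) (>⇒≤ᵇ≡false {lo ⊔ y0} {z} z<floor)
    where
    z<floor : z ℚ.< lo ⊔ y0
    z<floor = ℚP.<-≤-trans
      (≤ᵇ≡false⇒> {cap hi y0} (not≡true (∧-conicalʳ (lo ≤ᵇ z) (not (cap hi y0 ≤ᵇ z)) e)))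
      (cap≤floor lo hi y0)

  below-above-cover : ∀ J y0 z → inIntᵇ I J z ≡ true → inIntᵇ I (below I J y0) z ≡ false →
                      inIntᵇ I (above I J y0) z ≡ true
  below-above-cover [ lo , hi ⟩ y0 z e f =
    ∧-intro (≤⇒≤ᵇ≡true {lo ⊔ y0} {z} (ℚP.⊔-lub lo≤z (cap-reached hi y0 z z<hi cap≤z))) z<hi
    where
    lo≤z : lo ℚ.≤ z
    lo≤z = ≤ᵇ≡true⇒≤ {lo} (∧-conicalˡ (lo ≤ᵇ z) (upper hi z) e)
    z<hi : upper hi z ≡ true
    z<hi = ∧-conicalʳ (lo ≤ᵇ z) (upper hi z) e
    cap≤z : cap hi y0 ℚ.≤ z
    cap≤z = ≤ᵇ≡true⇒≤ {cap hi y0} (not≡false (∧-falseʳ (∧-conicalˡ (lo ≤ᵇ z) (upper hi z) e) f))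

  ∧-below : ∀ J y0 z → inIntᵇ I J z ∧ inIntᵇ I (below I J y0) z ≡ inIntᵇ I (below I J y0) z
  ∧-below J y0 z with inIntᵇ I (below I J y0) z in b
  ... | true  = trans (∧-identityʳ _) (below-⊆ J y0 z b)
  ... | false = ∧-zeroʳ _

  ∧-not-below : ∀ J y0 z → inIntᵇ I J z ∧ not (inIntᵇ I (below I J y0) z) ≡ inIntᵇ I (above I J y0) z
  ∧-not-below J y0 z with inIntᵇ I (below I J y0) z in b | inIntᵇ I J z in j
  ... | true  | _     = trans (∧-zeroʳ _) (sym (below-above-disjoint J y0 z b))
  ... | false | true  = sym (below-above-cover J y0 z j b)
  ... | false | false = sym (contraposeᵇ (above-⊆ J y0 z) j)

-- Segments of L̃_R and the sets R_w

module Segments (I : UFP) (Tstar : TaskSet) where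
  open UFP I using (m; t)

  inside : Interval I → ℕ → Bool
  inside J i = inIntᵇ I J (y I i)

  segContains-left : ∀ {v} i → 1 ≤ v → segContainsᵇ I i (suc v) ≡ true → segContainsᵇ I i v ≡ true
  segContains-left {v} i 1≤v e = ∧-intro (T⇒≡true (ℕP.≤⇒≤ᵇ 1≤v)) (T⇒≡true (ℕP.≤⇒≤ᵇ v+1<t))
    where
    v+1<t : suc v ≤ t i
    v+1<t = ℕP.≤-trans (ℕP.n≤1+n (suc v))
                       (ℕP.≤ᵇ⇒≤ _ _ (≡true⇒T (∧-conicalʳ (1 ℕ.≤ᵇ suc v) _ e)))

  inRᵇ-intro : ∀ v J i → Tstar i ≡ true → segContainsᵇ I i v ≡ true → inside J i ≡ true →
               inRᵇ I Tstar v J i ≡ true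
  inRᵇ-intro v J i ti si ji = ∧-intro ti (∧-intro si ji)

  inRᵇ-Tstar : ∀ v J i → inRᵇ I Tstar v J i ≡ true → Tstar i ≡ true
  inRᵇ-Tstar v J i e = ∧-conicalˡ (Tstar i) _ e

  inRᵇ-segContains : ∀ v J i → inRᵇ I Tstar v J i ≡ true → segContainsᵇ I i v ≡ true
  inRᵇ-segContains v J i e = ∧-conicalˡ (segContainsᵇ I i v) _ (∧-conicalʳ (Tstar i) _ e)

  inRᵇ-inside : ∀ v J i → inRᵇ I Tstar v J i ≡ true → inside J i ≡ true
  inRᵇ-inside v J i e = ∧-conicalʳ (segContainsᵇ I i v) _ (∧-conicalʳ (Tstar i) _ e)

  inRᵇ-∧ : ∀ v J i b → inRᵇ I Tstar v J i ∧ b ≡ Tstar i ∧ segContainsᵇ I i v ∧ (inside J i ∧ b)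
  inRᵇ-∧ v J i b = trans (∧-assoc (Tstar i) _ b) (cong (Tstar i ∧_) (∧-assoc (segContainsᵇ I i v) _ b))

  size : ℕ → Interval I → ℕ
  size v J = count m (inRᵇ I Tstar v J)

  cnt≡size : ∀ v J → cnt I Tstar v J ≡ size v J
  cnt≡size v J = length-filter-labels m (inRᵇ I Tstar v J)

  size-left : ∀ {v} J → 1 ≤ v → size (suc v) J ≤ size v J
  size-left {v} J 1≤v = count-mono m λ i _ e →
    inRᵇ-intro v J i (inRᵇ-Tstar (suc v) J i e) (segContains-left i 1≤v (inRᵇ-segContains (suc v) J i e))
               (inRᵇ-inside (suc v) J i e)

  size-split : ∀ v J y0 → size v J ≡ size v (below I J y0) + size v (above I J y0)
  size-split v J y0 = trans (count-split m (inRᵇ I Tstar v J) (inside (below I J y0)))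
    (cong₂ _+_ (count-cong m λ i _ → trans (inRᵇ-∧ v J i _) (cong (restrict i) (∧-below I J y0 (y I i))))
               (count-cong m λ i _ → trans (inRᵇ-∧ v J i _) (cong (restrict i) (∧-not-below I J y0 (y I i)))))
    where
    restrict : ℕ → Bool → Bool
    restrict i b = Tstar i ∧ segContainsᵇ I i v ∧ b

  bottom-size : ∀ {k q} v J y0 → k ≡ q * 2 → cnt I Tstar v (below I J y0) ≡ k ℕ./ 2 →
                size v (below I J y0) ≡ q
  bottom-size {k} {q} v J y0 k≡q*2 cnt≡k/2 =
    trans (sym (cnt≡size v (below I J y0))) (trans cnt≡k/2 (trans (cong (ℕ._/ 2) k≡q*2) (m*n/n≡m q 2)))

  top-size : ∀ {k q} v J y0 → k ≡ q * 2 → k ≤ cnt I Tstar v J → size v (below I J y0) ≡ q →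
             q ≤ size v (above I J y0)
  top-size {k} {q} v J y0 k≡q*2 k≤cnt size-b≡q = ℕP.+-cancelˡ-≤ q q (size v (above I J y0)) (begin
    q + q                                     ≡⟨ trans k≡q*2 (q*2≡q+q q) ⟨
    k                                         ≤⟨ k≤cnt ⟩
    cnt I Tstar v J                           ≡⟨ cnt≡size v J ⟩
    size v J                                  ≡⟨ size-split v J y0 ⟩
    size v (below I J y0) + size v (above I J y0) ≡⟨ cong (_+ size v (above I J y0)) size-b≡q ⟩
    q + size v (above I J y0)                 ∎)
    where open ℕP.≤-Reasoning

  Hit : TaskSet → ℕ → Interval I → Set
  Hit S v J = ∃ λ i → S i ≡ true × inRᵇ I Tstar v J i ≡ true

  hit-mono : ∀ {S S′ : TaskSet} v J → (∀ i → inside J i ≡ true → S i ≡ true → S′ i ≡ true) →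
             Hit S v J → Hit S′ v J
  hit-mono v J S⇒S′ (i , Si , i∈R) = i , S⇒S′ i (inRᵇ-inside v J i i∈R) Si , i∈R

  HitsAll-mono : ∀ {S S′ : TaskSet} v J D → (∀ i → inside J i ≡ true → S i ≡ true → S′ i ≡ true) →
                 HitsAll I Tstar S v J D → HitsAll I Tstar S′ v J D
  HitsAll-mono v J leaf    S⇒S′ (hit , _)    = hit-mono v J S⇒S′ hit , tt
  HitsAll-mono v J (one D) S⇒S′ (hit , rest) = hit-mono v J S⇒S′ hit , HitsAll-mono (v ∸ 1) J D S⇒S′ rest
  HitsAll-mono v J (two y0 Db Dt) S⇒S′ (hit , rest-b , rest-t) =
    hit-mono v J S⇒S′ hit ,
    HitsAll-mono (v ∸ 1) (below I J y0) Db (λ i i∈Jb → S⇒S′ i (below-⊆ I J y0 (y I i) i∈Jb)) rest-b ,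
    HitsAll-mono (v ∸ 1) (above I J y0) Dt (λ i i∈Jt → S⇒S′ i (above-⊆ I J y0 (y I i) i∈Jt)) rest-t

-- Greedy colouring of 𝒟

module Colouring (I : UFP) (Tstar : TaskSet) (q : ℕ) where
  open UFP I using (m)
  open Segments I Tstar

  -- Colour 0 marks an uncoloured segment; the colours are 1, …, q.
  Colouring : Set
  Colouring = ℕ → ℕ

  class : Colouring → ℕ → TaskSet
  class g c i = does (g i ≟ c)

  Admissible : Colouring → Set
  Admissible g = ∀ i → 1 ≤ g i → Label m i × Tstar i ≡ true × g i ≤ q

  class-⊆ : ∀ {g c} → Admissible g → Label q c → class g c ⊆ₜ Tstar
  class-⊆ {g} {c} adm (1≤c , _) i e =
    proj₁ (proj₂ (adm i (subst (1 ≤_) (sym (witness (g i ≟ c) e)) 1≤c)))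

  _⊑_ : Colouring → Colouring → Set
  g ⊑ h = ∀ i → 1 ≤ g i → h i ≡ g i

  ⊑-trans : ∀ {f g h} → f ⊑ g → g ⊑ h → f ⊑ h
  ⊑-trans f⊑g g⊑h i 1≤fi = trans (g⊑h i (subst (1 ≤_) (sym (f⊑g i 1≤fi)) 1≤fi)) (f⊑g i 1≤fi)

  hit-⊑ : ∀ {g h} v J c → 1 ≤ c → g ⊑ h → Hit (class g c) v J → Hit (class h c) v J
  hit-⊑ {g} {h} v J c 1≤c g⊑h = hit-mono v J λ i _ e →
    let gi≡c = witness (g i ≟ c) e in
    dec-true (h i ≟ c) (trans (g⊑h i (subst (1 ≤_) (sym gi≡c) 1≤c)) gi≡c)

  -- The invariant below a node (v, J): the coloured segments of height in J
  -- already lie in R(v, J) and have distinct colours.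
  record Proper (v : ℕ) (J : Interval I) (g : Colouring) : Set where
    field
      admissible : Admissible g
      reach      : ∀ i → 1 ≤ g i → inside J i ≡ true → segContainsᵇ I i v ≡ true
      rainbow    : ∀ i j → 1 ≤ g i → g i ≡ g j → inside J i ≡ true → inside J j ≡ true → i ≡ j

  uncoloured-proper : ∀ {v J} → Proper v J (λ _ → 0)
  uncoloured-proper = record { admissible = λ _ () ; reach = λ _ () ; rainbow = λ _ _ () }

  Proper-descend : ∀ {v J J′ g} → 1 ≤ v → (∀ i → inside J′ i ≡ true → inside J i ≡ true) →
                   Proper (suc v) J g → Proper v J′ g
  Proper-descend 1≤v J′⊆J p = record
    { admissible = admissible
    ; reach      = λ i 1≤gi i∈J′ → segContains-left i 1≤v (reach i 1≤gi (J′⊆J i i∈J′))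
    ; rainbow    = λ i j 1≤gi gi≡gj i∈J′ j∈J′ →
        rainbow i j 1≤gi gi≡gj (J′⊆J i i∈J′) (J′⊆J j j∈J′)
    }
    where open Proper p

  Proper-transfer : ∀ {v J g h} → Admissible h → (∀ i → inside J i ≡ true → h i ≡ g i) →
                    Proper v J g → Proper v J h
  Proper-transfer adm h≡g p = record
    { admissible = adm
    ; reach      = λ i 1≤hi i∈J → reach i (subst (1 ≤_) (h≡g i i∈J) 1≤hi) i∈J
    ; rainbow    = λ i j 1≤hi hi≡hj i∈J j∈J →
        rainbow i j (subst (1 ≤_) (h≡g i i∈J) 1≤hi)
                    (trans (sym (h≡g i i∈J)) (trans hi≡hj (h≡g j j∈J))) i∈J j∈J
    }
    where open Proper p

  ColourAbsent : Interval I → Colouring → ℕ → Set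
  ColourAbsent J g c = ∀ j → 1 ≤ g j → inside J j ≡ true → g j ≢ c

  absent-if-unseen : ∀ {v J g c} → Proper v J g →
                     (∀ i → Label m i → class g c i ∧ inRᵇ I Tstar v J i ≡ false) → ColourAbsent J g c
  absent-if-unseen {v} {J} {g} {c} p unseen j 1≤gj j∈J gj≡c =
    true≢false (∧-intro {class g c j} {inRᵇ I Tstar v J j} (dec-true (g j ≟ c) gj≡c) j∈R)
               (unseen j (proj₁ (admissible j 1≤gj)))
    where
    open Proper p
    j∈R : inRᵇ I Tstar v J j ≡ true
    j∈R = inRᵇ-intro v J j (proj₁ (proj₂ (admissible j 1≤gj))) (reach j 1≤gj j∈J) j∈J

  -- Pigeonhole: the coloured members of R(v, J) inject into the q − 1 colours other than s.
  uncoloured-member : ∀ {v J g s} → Proper v J g → q ≤ size v J → Label q s → ColourAbsent J g s →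
                      ∃ λ u → Label m u × inRᵇ I Tstar v J u ≡ true × g u ≡ 0
  uncoloured-member {v} {J} {g} {s} p q≤size ls absent = pick (count-pos m _ 1≤#uncoloured)
    where
    open Proper p
    member uncoloured : ℕ → Bool
    member       = inRᵇ I Tstar v J
    uncoloured i = does (g i ≟ 0)
    pick : (∃ λ u → Label m u × member u ∧ uncoloured u ≡ true) →
           ∃ λ u → Label m u × member u ≡ true × g u ≡ 0
    pick (u , lu , e) = u , lu , ∧-conicalˡ (member u) (uncoloured u) e ,
                        witness (g u ≟ 0) (∧-conicalʳ (member u) (uncoloured u) e)
    coloured : ∀ i → member i ∧ not (uncoloured i) ≡ true → 1 ≤ g i
    coloured i e = ℕP.n≢0⇒n>0 λ gi≡0 →
      true≢false (dec-true (g i ≟ 0) gi≡0) (not≡true (∧-conicalʳ (member i) (not (uncoloured i)) e))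
    inside-of : ∀ i → member i ∧ not (uncoloured i) ≡ true → inside J i ≡ true
    inside-of i e = inRᵇ-inside v J i (∧-conicalˡ (member i) (not (uncoloured i)) e)
    into : ∀ i → Label m i → member i ∧ not (uncoloured i) ≡ true →
           Label q (g i) × not (does (g i ≟ s)) ≡ true
    into i _ e = (coloured i e , proj₂ (proj₂ (admissible i (coloured i e)))) ,
                 cong not (dec-false (g i ≟ s) (absent i (coloured i e) (inside-of i e)))
    #coloured<q : suc (count m (λ i → member i ∧ not (uncoloured i))) ≤ q
    #coloured<q = ℕP.≤-trans (s≤s (count-injective q m g into λ i j _ _ ei ej gi≡gj →
                                     rainbow i j (coloured i ei) gi≡gj (inside-of i ei) (inside-of j ej)))
                             (count-missing q ls)
    1≤#uncoloured : 1 ≤ count m (λ i → member i ∧ uncoloured i)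
    1≤#uncoloured = ℕP.+-cancelʳ-≤ _ 1 _ (ℕP.≤-trans #coloured<q
                      (ℕP.≤-trans q≤size (ℕP.≤-reflexive (count-split m member uncoloured))))

  paint : Colouring → ℕ → ℕ → Colouring
  paint g u c i = if does (i ≟ u) then c else g i

  paint-at : ∀ g u c → paint g u c u ≡ c
  paint-at g u c = cong (λ b → if b then c else g u) (dec-true (u ≟ u) refl)

  paint-cases : ∀ g u c i → (i ≡ u × paint g u c i ≡ c) ⊎ (i ≢ u × paint g u c i ≡ g i)
  paint-cases g u c i with i ≟ u
  ... | yes i≡u = inj₁ (i≡u , cong (λ b → if b then c else g i) (dec-true (i ≟ u) i≡u))
  ... | no  i≢u = inj₂ (i≢u , cong (λ b → if b then c else g i) (dec-false (i ≟ u) i≢u))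

  ⊑-paint : ∀ {g u} c → g u ≡ 0 → g ⊑ paint g u c
  ⊑-paint {g} {u} c gu≡0 i 1≤gi = case paint-cases g u c i of λ where
    (inj₁ (i≡u , _)) → ⊥-elim (ℕP.<⇒≢ 1≤gi (sym (subst (λ x → g x ≡ 0) (sym i≡u) gu≡0)))
    (inj₂ (_ , eq))  → eq

  paint-proper : ∀ {v J g u c} → Proper v J g → Label m u → inRᵇ I Tstar v J u ≡ true → Label q c →
                 ColourAbsent J g c → Proper v J (paint g u c)
  paint-proper {v} {J} {g} {u} {c} p lu u∈R (1≤c , c≤q) absent = record
    { admissible = admissible′ ; reach = reach′ ; rainbow = rainbow′ }
    where
    open Proper p
    g′ = paint g u c
    admissible′ : Admissible g′
    admissible′ i 1≤g′i = case paint-cases g u c i of λ where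
      (inj₁ (i≡u , _)) → subst (λ x → Label m x × Tstar x ≡ true × g′ x ≤ q) (sym i≡u)
                            (lu , inRᵇ-Tstar v J u u∈R , subst (_≤ q) (sym (paint-at g u c)) c≤q)
      (inj₂ (_ , eq))  → map₂ (map₂ (subst (_≤ q) (sym eq))) (admissible i (subst (1 ≤_) eq 1≤g′i))
    reach′ : ∀ i → 1 ≤ g′ i → inside J i ≡ true → segContainsᵇ I i v ≡ true
    reach′ i 1≤g′i i∈J = case paint-cases g u c i of λ where
      (inj₁ (i≡u , _)) → subst (λ x → segContainsᵇ I x v ≡ true) (sym i≡u) (inRᵇ-segContains v J u u∈R)
      (inj₂ (_ , eq))  → reach i (subst (1 ≤_) eq 1≤g′i) i∈J
    rainbow′ : ∀ i j → 1 ≤ g′ i → g′ i ≡ g′ j → inside J i ≡ true → inside J j ≡ true → i ≡ j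
    rainbow′ i j 1≤g′i g′i≡g′j i∈J j∈J = case paint-cases g u c i , paint-cases g u c j of λ where
      (inj₁ (i≡u , _) , inj₁ (j≡u , _)) → trans i≡u (sym j≡u)
      (inj₁ (_ , ei)  , inj₂ (_ , ej))  →
        let gj≡c = trans (sym ej) (trans (sym g′i≡g′j) ei) in
        ⊥-elim (absent j (subst (1 ≤_) (sym gj≡c) 1≤c) j∈J gj≡c)
      (inj₂ (_ , ei)  , inj₁ (_ , ej))  →
        let gi≡c = trans (sym ei) (trans g′i≡g′j ej) in
        ⊥-elim (absent i (subst (1 ≤_) (sym gi≡c) 1≤c) i∈J gi≡c)
      (inj₂ (_ , ei)  , inj₂ (_ , ej))  →
        rainbow i j (subst (1 ≤_) ei 1≤g′i) (trans (sym ei) (trans g′i≡g′j ej)) i∈J j∈J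

  record Refinement (v : ℕ) (J : Interval I) (g : Colouring) (n : ℕ) : Set where
    field
      colouring : Colouring
      proper    : Proper v J colouring
      extends   : g ⊑ colouring
      fixed     : ∀ i → inside J i ≡ false → colouring i ≡ g i
      hits      : ∀ c → Label n c → Hit (class colouring c) v J

  hits-suc : ∀ g v J {n} → (∀ c → Label n c → Hit (class g c) v J) → Hit (class g (suc n)) v J →
             ∀ c → Label (suc n) c → Hit (class g c) v J
  hits-suc g v J old new c lc = case Label-split lc of λ where
    (inj₁ lc′) → old c lc′
    (inj₂ c≡)  → subst (λ x → Hit (class g x) v J) (sym c≡) new

  paint-refinement : ∀ {v J g n} → suc n ≤ q → (r : Refinement v J g n) →
                     ColourAbsent J (Refinement.colouring r) (suc n) →
                     (∃ λ u → Label m u × inRᵇ I Tstar v J u ≡ true × Refinement.colouring r u ≡ 0) →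
                     Refinement v J g (suc n)
  paint-refinement {v} {J} {g} {n} n<q r absent (u , lu , u∈R , g₁u≡0) = record
    { colouring = g₂
    ; proper    = paint-proper proper lu u∈R (s≤s z≤n , n<q) absent
    ; extends   = ⊑-trans extends g₁⊑g₂
    ; fixed     = fixed′
    ; hits      = hits-suc g₂ v J (λ c lc → hit-⊑ v J c (proj₁ lc) g₁⊑g₂ (hits c lc))
                                (u , dec-true (g₂ u ≟ suc n) (paint-at g₁ u (suc n)) , u∈R)
    }
    where
    open Refinement r renaming (colouring to g₁)
    g₂ = paint g₁ u (suc n)
    g₁⊑g₂ : g₁ ⊑ g₂
    g₁⊑g₂ = ⊑-paint (suc n) g₁u≡0
    fixed′ : ∀ i → inside J i ≡ false → g₂ i ≡ g i
    fixed′ i i∉J = case paint-cases g₁ u (suc n) i of λ where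
      (inj₁ (i≡u , _)) →
        ⊥-elim (true≢false (inRᵇ-inside v J u u∈R) (subst (λ x → inside J x ≡ false) i≡u i∉J))
      (inj₂ (_ , eq))  → trans eq (fixed i i∉J)

  add-colour : ∀ {v J g n} → suc n ≤ q → q ≤ size v J → Refinement v J g n → Refinement v J g (suc n)
  add-colour {v} {J} {g} {n} n<q q≤size r = extend (search m λ i → class g₁ (suc n) i ∧ inRᵇ I Tstar v J i)
    where
    open Refinement r renaming (colouring to g₁)
    extend : (∃ λ i → Label m i × class g₁ (suc n) i ∧ inRᵇ I Tstar v J i ≡ true) ⊎
             (∀ i → Label m i → class g₁ (suc n) i ∧ inRᵇ I Tstar v J i ≡ false) →
             Refinement v J g (suc n)
    extend (inj₁ (i , _ , e)) = record
      { colouring = g₁ ; proper = proper ; extends = extends ; fixed = fixed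
      ; hits = hits-suc g₁ v J hits (i , ∧-conicalˡ (class g₁ (suc n) i) (inRᵇ I Tstar v J i) e ,
                                       ∧-conicalʳ (class g₁ (suc n) i) (inRᵇ I Tstar v J i) e) }
    extend (inj₂ unseen) =
      paint-refinement n<q r absent (uncoloured-member proper q≤size (s≤s z≤n , n<q) absent)
      where
      absent : ColourAbsent J g₁ (suc n)
      absent = absent-if-unseen proper unseen

  fill-upto : ∀ {v J g} n → n ≤ q → q ≤ size v J → Proper v J g → Refinement v J g n
  fill-upto {g = g} zero _ _ p = record
    { colouring = g ; proper = p ; extends = λ _ _ → refl ; fixed = λ _ _ → refl
    ; hits = λ _ lc → ⊥-elim (Label-zero lc) }
  fill-upto (suc n) n<q q≤size p = add-colour n<q q≤size (fill-upto n (ℕP.<⇒≤ n<q) q≤size p)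

  record SubtreeColouring (v : ℕ) (J : Interval I) (D : DTree) (g : Colouring) : Set where
    field
      colouring  : Colouring
      admissible : Admissible colouring
      extends    : g ⊑ colouring
      fixed      : ∀ i → inside J i ≡ false → colouring i ≡ g i
      hits-all   : ∀ c → Label q c → HitsAll I Tstar (class colouring c) v J D

  module _ {k : ℕ} (k≡q*2 : k ≡ q * 2) where

    colour-subtree : ∀ {v J D g} → ValidNode I Tstar k v J D → q ≤ size v J → Proper v J g →
                     SubtreeColouring v J D g
    colour-subtree v-leaf q≤size p = record
      { colouring = F.colouring ; admissible = Proper.admissible F.proper ; extends = F.extends
      ; fixed = F.fixed ; hits-all = λ c lc → F.hits c lc , tt }
      where module F = Refinement (fill-upto q ℕP.≤-refl q≤size p)
    colour-subtree {suc v} {J} (v-one 1≤v _ valid) q≤size p = record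
      { colouring  = S.colouring
      ; admissible = S.admissible
      ; extends    = ⊑-trans F.extends S.extends
      ; fixed      = λ i i∉J → trans (S.fixed i i∉J) (F.fixed i i∉J)
      ; hits-all   = λ c lc → hit-⊑ (suc v) J c (proj₁ lc) S.extends (F.hits c lc) , S.hits-all c lc
      }
      where
      module F = Refinement (fill-upto q ℕP.≤-refl q≤size p)
      module S = SubtreeColouring (colour-subtree valid (ℕP.≤-trans q≤size (size-left J 1≤v))
                                                       (Proper-descend 1≤v (λ _ i∈J → i∈J) F.proper))
    -- The bottom subtree is coloured first; it changes colours of heights in Jb
    -- only, so the top subtree starts from a proper colouring of Jt, and in turn
    -- leaves the colours on Jb alone.
    colour-subtree {suc v} {J} {two y0 Db Dt} (v-two 1≤v k≤size size-below valid-b valid-t) q≤size p = record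
      { colouring  = T.colouring
      ; admissible = T.admissible
      ; extends    = ⊑-trans F.extends (⊑-trans B.extends T.extends)
      ; fixed      = λ i i∉J → trans (T.fixed i (contraposeᵇ (above-⊆ I J y0 (y I i)) i∉J))
                                (trans (B.fixed i (contraposeᵇ (below-⊆ I J y0 (y I i)) i∉J)) (F.fixed i i∉J))
      ; hits-all   = λ c lc →
          hit-⊑ (suc v) J c (proj₁ lc) (⊑-trans B.extends T.extends) (F.hits c lc) ,
          HitsAll-mono v Jb Db (λ i i∈Jb e → trans (cong (λ x → does (x ≟ c)) (T-on-Jb i i∈Jb)) e)
                       (B.hits-all c lc) ,
          T.hits-all c lc
      }
      where
      Jb = below I J y0
      Jt = above I J y0
      module F = Refinement (fill-upto q ℕP.≤-refl q≤size p)
      size-b≡q : size v Jb ≡ q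
      size-b≡q = bottom-size v J y0 k≡q*2 size-below
      module B = SubtreeColouring (colour-subtree valid-b (ℕP.≤-reflexive (sym size-b≡q))
                                    (Proper-descend 1≤v (λ i → below-⊆ I J y0 (y I i)) F.proper))
      B-on-Jt : ∀ i → inside Jt i ≡ true → B.colouring i ≡ F.colouring i
      B-on-Jt i i∈Jt = B.fixed i (excludes-sym (below-above-disjoint I J y0 (y I i)) i∈Jt)
      module T = SubtreeColouring (colour-subtree valid-t (top-size v J y0 k≡q*2 k≤size size-b≡q)
                                    (Proper-transfer B.admissible B-on-Jt
                                      (Proper-descend 1≤v (λ i → above-⊆ I J y0 (y I i)) F.proper)))
      T-on-Jb : ∀ i → inside Jb i ≡ true → T.colouring i ≡ B.colouring i
      T-on-Jb i i∈Jb = T.fixed i (below-above-disjoint I J y0 (y I i) i∈Jb)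

-- Weights

profits-nonneg : ∀ I → Standing I → ∀ i → Label (UFP.m I) i → 0ℚ ℚ.≤ UFP.w I i
profits-nonneg I st i (1≤i , i≤m) = WellFormed.w-nonneg (Standing.wf st) i 1≤i i≤m

module Weights (I : UFP) (Tstar : TaskSet) (w≥0 : ∀ i → Label (UFP.m I) i → 0ℚ ℚ.≤ UFP.w I i) where
  open UFP I using (m; w)

  weight-summand-nonneg : ∀ i → Label m i → ∀ b → 0ℚ ℚ.≤ (if b then w i else 0ℚ)
  weight-summand-nonneg i li true  = w≥0 i li
  weight-summand-nonneg i li false = ℚP.≤-refl

  empty-weight : ∀ x → x ℚ.* weight I (λ _ → false) ℚ.≤ weight I Tstar
  empty-weight x = begin
    x ℚ.* weight I (λ _ → false) ≡⟨ cong (x ℚ.*_) (sumTo-zero m (λ _ _ → refl)) ⟩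
    x ℚ.* 0ℚ                     ≡⟨ ℚP.*-zeroʳ x ⟩
    0ℚ                           ≡⟨ sumTo-zero m (λ _ _ → refl) ⟨
    sumTo m (λ _ → 0ℚ)           ≤⟨ sumTo-mono m (λ i li → weight-summand-nonneg i li (Tstar i)) ⟩
    weight I Tstar               ∎
    where open ℚP.≤-Reasoning

  module _ (q : ℕ) where
    open Colouring I Tstar q

    class-weights : ∀ {h} → Admissible h → sumTo q (λ c → weight I (class h c)) ℚ.≤ weight I Tstar
    class-weights {h} adm = begin
      sumTo q (λ c → weight I (class h c))                             ≡⟨ sumTo-swap q m _ ⟩
      sumTo m (λ i → sumTo q (λ c → if does (h i ≟ c) then w i else 0ℚ)) ≤⟨ sumTo-mono m per-task ⟩
      weight I Tstar                                                   ∎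
      where
      open ℚP.≤-Reasoning
      per-task : ∀ i → Label m i →
                 sumTo q (λ c → if does (h i ≟ c) then w i else 0ℚ) ℚ.≤ (if Tstar i then w i else 0ℚ)
      per-task i li = case h i ≟ 0 of λ where
        (yes hi≡0) → subst (ℚ._≤ _)
                       (sym (sumTo-zero q λ c (1≤c , _) → cong (λ b → if b then w i else 0ℚ)
                          (dec-false (h i ≟ c) λ hi≡c → ℕP.<⇒≢ 1≤c (trans (sym hi≡0) hi≡c))))
                       (weight-summand-nonneg i li (Tstar i))
        (no hi≢0)  → let 1≤hi = ℕP.n≢0⇒n>0 hi≢0 in
                     subst₂ ℚ._≤_ (sym (sumTo-single q (w i) (1≤hi , proj₂ (proj₂ (adm i 1≤hi)))))
                                  (cong (λ b → if b then w i else 0ℚ) (sym (proj₁ (proj₂ (adm i 1≤hi)))))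
                                  ℚP.≤-refl

    cheapest-class : ∀ {h} → Admissible h → 1 ≤ q →
                     ∃ λ c → Label q c × ι q ℚ.* weight I (class h c) ℚ.≤ weight I Tstar
    cheapest-class {h} adm 1≤q with c , lc , cheap ← cheapest q (λ c → weight I (class h c)) 1≤q =
      c , lc , ℚP.≤-trans cheap (class-weights adm)

lemma14 : (I : UFP) → Standing I →
          (Tstar : TaskSet) → Optimal I Tstar →
          (k : ℕ) → 2 ≤ k → 2 ∣ k →
          (D : Maybe (ℕ × DTree)) → IsTreeD I Tstar k D →
          ∃ λ S → SegmentCover I Tstar D S ×
            (ι k ℚ.* weight I S ℚ.≤ ι 2 ℚ.* weight I Tstar)
lemma14 I st Tstar _ k _ (divides q k≡q*2) nothing _ =
  (λ _ → false) , (λ _ ()) , double-scaling q k≡q*2 (empty-weight (ι q))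
  where open Weights I Tstar (profits-nonneg I st)
lemma14 I st Tstar _ k 2≤k (divides q k≡q*2) (just (r , D)) (_ , _ , k-1≤cnt , _ , valid) =
  class C.colouring c , (class-⊆ C.admissible lc , C.hits-all c lc) , double-scaling q k≡q*2 cheap
  where
  open Weights I Tstar (profits-nonneg I st)
  open Colouring I Tstar q
  open Segments I Tstar using (size; cnt≡size)
  q≤size : q ≤ size r (whole I)
  q≤size = ℕP.≤-trans (half≤pred 2≤k k≡q*2)
                      (ℕP.≤-trans k-1≤cnt (ℕP.≤-reflexive (cnt≡size r (whole I))))
  module C = SubtreeColouring (colour-subtree k≡q*2 valid q≤size uncoloured-proper)
  cheapest-colour = cheapest-class q C.admissible (1≤half 2≤k k≡q*2)
  c    = proj₁ cheapest-colour
  lc   = proj₁ (proj₂ cheapest-colour)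
  cheap = proj₂ (proj₂ cheapest-colour)
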